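{- Let $(G,W,R,k)$ be a YES instance of \textsc{Disjoint Independent Feedback Vertex Set}. Then its measure satisfies $\mu\ge 0$.
   Context: Graphs are undirected and may contain multiple edges and loops. \textsc{Disjoint Independent Feedback Vertex Set}: the input is an undirected (multi)graph $G$, a set $W\subseteq V(G)$ such that $G\setminus W$ is a forest, a set $R\subseteq V(G)\setminus W$, and an integer $k$; it is a YES instance if there exists a set $X\subseteq V(G)\setminus(W\cup R)$ with $|X|\le k$ such that $X$ is an independent set in $G$ and $G\setminus X$ is a forest. Let $F=V(G)\setminus W$. For $v\in V(G)$ and $A\subseteq V(G)$, $\deg_A(v)$ is the number of edges (counted with multiplicity) with one endpoint $v$ and the other in $A$. A vertex $v\in F\setminus R$ is \emph{nice} if $\deg_W(v)=2$ and $v$ has no neighbors in $F$; it is a \emph{tent} if $\deg_W(v)=3$ and $v$ has no neighbors in $F$. The measure of the instance is $\mu=k+\rho-(\eta+\tau)$, where $\rho$ is the number of connected components of $G[W]$, $\eta$ is the number of nice vertices and $\tau$ is the number of tents. -}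

module Defs where

open import Data.Nat using (ℕ; zero; suc; _<_; _<?_; s≤s; _+_)
open import Data.Fin using (Fin; zero; suc; toℕ; fromℕ<)
open import Data.Fin.Subset using (Subset; _∈_; _∉_)
open import Data.Bool using (Bool; true; false; _∧_; _∨_; not; if_then_else_)
open import Data.Vec using (lookup)
open import Data.List using (List; length; filter; _∷_; [])
import Data.List as L
open import Data.List.Membership.Propositional using () renaming (_∈_ to _∈ₗ_)
open import Data.Product using (_×_; _,_; Σ; ∃; ∃-syntax)
open import Data.Sum using (_⊎_)
open import Data.Empty using (⊥)
open import Relation.Nullary using (¬_; yes; no)
open import Relation.Binary.PropositionalEquality using (_≡_)
open import Function.Definitions using (Injective)
open import Function.Bundles using (_⇔_)

-- A finite undirected multigraph on vertex set Fin n is given by a list of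
-- edges (pairs of endpoints); repeated entries are parallel edges and pairs
-- (v , v) are loops.
Edges : ℕ → Set
Edges n = List (Fin n × Fin n)

Joins : ∀ {n} → Fin n × Fin n → Fin n → Fin n → Set
Joins e u v = e ≡ (u , v) ⊎ e ≡ (v , u)

cyc : ∀ {m} → Fin (suc m) → Fin (suc m)
cyc {m} i with suc (toℕ i) <? suc m
... | yes p = fromℕ< p
... | no _  = zero

-- A cycle in the subgraph G[S] induced by the vertex set S: distinct vertices
-- v_0 … v_m in S and distinct edges e_0 … e_m (as edge occurrences, i.e.
-- positions in the edge list) such that e_i joins v_i and v_{i+1 mod (m+1)}.
-- Length 1 = a loop, length 2 = a pair of parallel edges.
record Cycle {n} (E : Edges n) (S : Subset n) : Set where
  field
    m   : ℕ
    vs  : Fin (suc m) → Fin n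
    es  : Fin (suc m) → Fin (length E)
    vs-inj : Injective _≡_ _≡_ vs
    es-inj : Injective _≡_ _≡_ es
    vs-in  : ∀ i → vs i ∈ S
    joins  : ∀ i → Joins (L.lookup E (es i)) (vs i) (vs (cyc i))

IsForest : ∀ {n} → Edges n → Subset n → Set
IsForest E S = ¬ Cycle E S

Independent : ∀ {n} → Edges n → Subset n → Set
Independent E X = ∀ {u v} → (u , v) ∈ₗ E → u ∈ X → v ∈ X → ⊥

data Conn {n} (E : Edges n) (W : Subset n) (u : Fin n) : Fin n → Set where
  here : u ∈ W → Conn E W u u
  step : ∀ {v w e} → Conn E W u v → e ∈ₗ E → Joins e v w → w ∈ W → Conn E W u w

-- G[W] has exactly ρ connected components: there is a labelling of the
-- vertices of W by Fin ρ, onto, whose fibres are exactly the components.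
NumComponents : ∀ {n} → Edges n → Subset n → ℕ → Set
NumComponents {n} E W ρ =
  Σ (Fin n → Fin ρ) λ c →
    (∀ j → ∃[ u ] (u ∈ W × c u ≡ j)) ×
    (∀ u v → u ∈ W → v ∈ W → (c u ≡ c v ⇔ Conn E W u v))

_=ᵇ_ : ∀ {n} → Fin n → Fin n → Bool
zero  =ᵇ zero  = true
suc a =ᵇ suc b = a =ᵇ b
_     =ᵇ _     = false

-- deg_A(v): number of edges (with multiplicity) with one endpoint v and the
-- other endpoint in A (a loop at v is counted once iff v ∈ A).
deg : ∀ {n} → Edges n → Subset n → Fin n → ℕ
deg [] A v = 0
deg ((a , b) ∷ E) A v =
  (if ((a =ᵇ v) ∧ lookup A b) ∨ ((b =ᵇ v) ∧ lookup A a) then 1 else 0) + deg E A v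

compl : ∀ {n} → Subset n → Subset n
compl = Data.Vec.map not

isSpecialᵇ : ∀ {n} → Edges n → Subset n → Subset n → ℕ → Fin n → Bool
isSpecialᵇ E W R d v =
  not (lookup W v) ∧ not (lookup R v) ∧ (deg E W v Data.Nat.≡ᵇ d)
    ∧ (deg E (compl W) v Data.Nat.≡ᵇ 0)

countV : ∀ {n} → (Fin n → Bool) → ℕ
countV {n} p = length (filter (λ v → Data.Bool._≟_ (p v) true) (Data.List.allFin n))

numNice : ∀ {n} → Edges n → Subset n → Subset n → ℕ
numNice E W R = countV (isSpecialᵇ E W R 2)

numTents : ∀ {n} → Edges n → Subset n → Subset n → ℕ
numTents E W R = countV (isSpecialᵇ E W R 3)

-- (G , W , R , k) is a YES instance (the input conditions W, R are separate)
IsYes : ∀ {n} → Edges n → Subset n → Subset n → ℕ → Set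
IsYes {n} E W R k =
  ∃[ X ] ((∀ {v} → v ∈ X → v ∉ W × v ∉ R)
         × Data.Nat._≤_ (Data.Fin.Subset.∣ X ∣) k
         × Independent E X
         × IsForest E (compl X))

module Submission where

-- Fix a solution X with |X| ≤ k such
-- that G ∖ X is a forest.  The nice vertices and tents inside X number at
-- most |X| ≤ k.  Every nice vertex or tent v outside X lies in the forest
-- G ∖ X, is not in W, and has at least two edge occurrences into W.  Add such
-- vertices to W one at a time: the two W-neighbours of a new vertex v cannot
-- already be connected through W and the earlier vertices, since that path
-- together with v would be a cycle in G ∖ X.  So each addition merges two of
-- the connectivity classes of W, of which there are at most ρ; hence at most
-- ρ vertices can be added.

open import Defs
open import Data.Nat.Properties using (≤-refl; ≤-pred; +-mono-≤; +-suc; m≤m+n; <-irrefl; ≡ᵇ⇒≡; module ≤-Reasoning)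
open import Algebra.Properties.CommutativeSemigroup Data.Nat.Properties.+-commutativeSemigroup
  using (interchange)
open import Data.Bool using (Bool; true; false; _∧_; _∨_; not)
import Data.Bool as B
open import Data.Empty using (⊥; ⊥-elim)
open import Data.Fin using (Fin; zero; suc; toℕ; fromℕ; inject₁; _≟_; punchOut)
open import Data.Fin.Properties
  using (toℕ-injective; toℕ-fromℕ<; toℕ-inject₁; toℕ-fromℕ; toℕ<n; suc-injective; any?; punchOut-injective)
open import Data.Fin.Subset using (Subset; _∈_; _∉_; ∣_∣)
open import Data.Fin.Subset.Properties using (x∉p⇒x∈∁p)
open import Data.Integer using (+_; _-_; +≤+)
import Data.Integer as ℤ
open import Data.Integer.Properties using (i≤j⇒0≤j-i)
open import Data.List using (List; []; _∷_; length; filter; tabulate; allFin)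
import Data.List as L
open import Data.List.Membership.Propositional using () renaming (_∈_ to _∈ₗ_; _∉_ to _∉ₗ_)
open import Data.List.Membership.Propositional.Properties using (∈-filter⁻)
open import Data.List.Relation.Unary.All.Properties using (All¬⇒¬Any)
open import Data.List.Relation.Unary.AllPairs using (_∷_)
open import Data.List.Relation.Unary.Any using (here; there; index)
open import Data.List.Relation.Unary.Any.Properties using (lookup-index)
open import Data.List.Relation.Unary.Unique.Propositional using (Unique)
open import Data.List.Relation.Unary.Unique.Propositional.Properties using (filter⁺; allFin⁺)
open import Data.Nat using (ℕ; zero; suc; _+_; _≤_; _<_; z≤n; s≤s; _<?_; _≡ᵇ_)
open import Data.Product using (Σ; Σ-syntax; ∃-syntax; _×_; _,_; proj₁; proj₂)
open import Data.Sum using (_⊎_; inj₁; inj₂)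
open import Data.Unit using (tt)
open import Data.Vec using (Vec; []; _∷_; lookup; _∷ʳ_)
open import Data.Vec.Properties using (lookup⇒[]=; []=⇒lookup)
open import Function using (id; _∘_)
open import Function.Bundles using (Equivalence)
open import Function.Definitions using (Injective)
open import Relation.Nullary using (¬_; yes; no)
open import Relation.Binary.PropositionalEquality

b2n : Bool → ℕ
b2n true  = 1
b2n false = 0

count : ∀ {n} → (Fin n → Bool) → ℕ
count {zero}  p = 0
count {suc n} p = b2n (p zero) + count (p ∘ suc)

filter-tabulate-length : ∀ {n m} (f : Fin n → Fin m) (q : Fin m → Bool) →
  length (filter (λ v → q v B.≟ true) (tabulate f)) ≡ count (q ∘ f)
filter-tabulate-length {zero}  f q = refl
filter-tabulate-length {suc n} f q with q (f zero)
... | true  = cong suc (filter-tabulate-length (f ∘ suc) q)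
... | false = filter-tabulate-length (f ∘ suc) q

countV≡count : ∀ {n} (p : Fin n → Bool) → countV p ≡ count p
countV≡count p = filter-tabulate-length id p

∣∣≡count : ∀ {n} (X : Subset n) → ∣ X ∣ ≡ count (lookup X)
∣∣≡count []          = refl
∣∣≡count (true ∷ X)  = cong suc (∣∣≡count X)
∣∣≡count (false ∷ X) = ∣∣≡count X

count-pointwise : ∀ {n} (p q r s : Fin n → Bool) →
  (∀ i → b2n (p i) + b2n (q i) ≤ b2n (r i) + b2n (s i)) →
  count p + count q ≤ count r + count s
count-pointwise {zero}  p q r s h = z≤n
count-pointwise {suc n} p q r s h = begin
  (b2n (p zero) + count (p ∘ suc)) + (b2n (q zero) + count (q ∘ suc))
    ≡⟨ interchange (b2n (p zero)) _ _ _ ⟩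
  (b2n (p zero) + b2n (q zero)) + (count (p ∘ suc) + count (q ∘ suc))
    ≤⟨ +-mono-≤ (h zero) (count-pointwise (p ∘ suc) (q ∘ suc) (r ∘ suc) (s ∘ suc) (h ∘ suc)) ⟩
  (b2n (r zero) + b2n (s zero)) + (count (r ∘ suc) + count (s ∘ suc))
    ≡⟨ interchange (b2n (r zero)) _ _ _ ⟩
  (b2n (r zero) + count (r ∘ suc)) + (b2n (s zero) + count (s ∘ suc)) ∎
  where open ≤-Reasoning

count-disjoint-split : ∀ {n} (p q x : Fin n → Bool) → (∀ i → p i ≡ true → q i ≡ true → ⊥) →
  count p + count q ≤ count x + count (λ i → (p i ∨ q i) ∧ not (x i))
count-disjoint-split p q x disjoint =
  count-pointwise p q x _ (λ i → indicators (p i) (q i) (x i) (disjoint i))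
  where
  indicators : ∀ a b c → (a ≡ true → b ≡ true → ⊥) → b2n a + b2n b ≤ b2n c + b2n ((a ∨ b) ∧ not c)
  indicators true  true  c     ab = ⊥-elim (ab refl refl)
  indicators true  false true  _  = s≤s z≤n
  indicators true  false false _  = s≤s z≤n
  indicators false true  true  _  = s≤s z≤n
  indicators false true  false _  = s≤s z≤n
  indicators false false c     _  = z≤n

∧-true : ∀ x {y} → x ∧ y ≡ true → x ≡ true × y ≡ true
∧-true true h = refl , h

∨-true : ∀ x {y} → x ∨ y ≡ true → x ≡ true ⊎ y ≡ true
∨-true true  _ = inj₁ refl
∨-true false h = inj₂ h

not-true : ∀ {x} → not x ≡ true → x ≡ false
not-true {false} _ = refl

lookup-false⇒∉ : ∀ {n} (p : Subset n) {x} → lookup p x ≡ false → x ∉ p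
lookup-false⇒∉ p h x∈p with trans (sym ([]=⇒lookup x∈p)) h
... | ()

=ᵇ⇒≡ : ∀ {n} (i j : Fin n) → (i =ᵇ j) ≡ true → i ≡ j
=ᵇ⇒≡ zero    zero    _ = refl
=ᵇ⇒≡ (suc i) (suc j) h = cong suc (=ᵇ⇒≡ i j h)

module _ {A : Set} where

  Distinct : ∀ {m} → Vec A m → Set
  Distinct xs = Injective _≡_ _≡_ (lookup xs)

  Fresh : A → ∀ {m} → Vec A m → Set
  Fresh x xs = ∀ i → lookup xs i ≢ x

  distinct-[] : Distinct []
  distinct-[] {()}

  distinct-∷ : ∀ {m x} {xs : Vec A m} → Fresh x xs → Distinct xs → Distinct (x ∷ xs)
  distinct-∷ x∉ d {zero}  {zero}  _ = refl
  distinct-∷ x∉ d {zero}  {suc j} e = ⊥-elim (x∉ j (sym e))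
  distinct-∷ x∉ d {suc i} {zero}  e = ⊥-elim (x∉ i e)
  distinct-∷ x∉ d {suc i} {suc j} e = cong suc (d e)

  distinct-head : ∀ {m x} {xs : Vec A m} → Distinct (x ∷ xs) → Fresh x xs
  distinct-head d i e with d {suc i} {zero} e
  ... | ()

  distinct-tail : ∀ {m x} {xs : Vec A m} → Distinct (x ∷ xs) → Distinct xs
  distinct-tail d e = suc-injective (d e)

  fresh-∷ʳ : ∀ {m x y} (xs : Vec A m) → Fresh x xs → y ≢ x → Fresh x (xs ∷ʳ y)
  fresh-∷ʳ []       x∉ y≢x zero    = y≢x
  fresh-∷ʳ (z ∷ xs) x∉ y≢x zero    = x∉ zero
  fresh-∷ʳ (z ∷ xs) x∉ y≢x (suc i) = fresh-∷ʳ xs (x∉ ∘ suc) y≢x i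

  distinct-∷ʳ : ∀ {m y} (xs : Vec A m) → Fresh y xs → Distinct xs → Distinct (xs ∷ʳ y)
  distinct-∷ʳ []       y∉ d = distinct-∷ (λ ()) distinct-[]
  distinct-∷ʳ (x ∷ xs) y∉ d =
    distinct-∷ (fresh-∷ʳ xs (distinct-head d) (λ e → y∉ zero (sym e)))
               (distinct-∷ʳ xs (y∉ ∘ suc) (distinct-tail d))

  lookup-∷ʳ-inject₁ : ∀ {m} (xs : Vec A m) y i → lookup (xs ∷ʳ y) (inject₁ i) ≡ lookup xs i
  lookup-∷ʳ-inject₁ (x ∷ xs) y zero    = refl
  lookup-∷ʳ-inject₁ (x ∷ xs) y (suc i) = lookup-∷ʳ-inject₁ xs y i

  lookup-∷ʳ-last : ∀ {m} (xs : Vec A m) y → lookup (xs ∷ʳ y) (fromℕ m) ≡ y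
  lookup-∷ʳ-last []       y = refl
  lookup-∷ʳ-last (x ∷ xs) y = lookup-∷ʳ-last xs y

inject₁-or-last : ∀ {m} (i : Fin (suc m)) → (Σ[ j ∈ Fin m ] i ≡ inject₁ j) ⊎ i ≡ fromℕ m
inject₁-or-last {zero}  zero    = inj₂ refl
inject₁-or-last {suc m} zero    = inj₁ (zero , refl)
inject₁-or-last {suc m} (suc i) with inject₁-or-last i
... | inj₁ (j , e) = inj₁ (suc j , cong suc e)
... | inj₂ e       = inj₂ (cong suc e)

cyc-inject₁ : ∀ {m} (j : Fin m) → cyc (inject₁ j) ≡ suc j
cyc-inject₁ {m} j with suc (toℕ (inject₁ j)) <? suc m
... | yes p = toℕ-injective (trans (toℕ-fromℕ< p) (cong suc (toℕ-inject₁ j)))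
... | no ¬p = ⊥-elim (¬p (s≤s (subst (_< m) (sym (toℕ-inject₁ j)) (toℕ<n j))))

cyc-last : ∀ m → cyc (fromℕ m) ≡ zero
cyc-last m with suc (toℕ (fromℕ m)) <? suc m
... | yes (s≤s p) = ⊥-elim (<-irrefl refl (subst (_≤ m) (cong suc (toℕ-fromℕ m)) p))
... | no _        = refl

lookup-∷ʳ-cyc : ∀ {A : Set} {m} (xs : Vec A (suc m)) (i : Fin (suc m)) →
  lookup (xs ∷ʳ lookup xs zero) (suc i) ≡ lookup xs (cyc i)
lookup-∷ʳ-cyc {m = m} xs i with inject₁-or-last i
... | inj₁ (j , refl) = trans (lookup-∷ʳ-inject₁ xs _ (suc j)) (cong (lookup xs) (sym (cyc-inject₁ j)))
... | inj₂ refl       = trans (lookup-∷ʳ-last xs _) (cong (lookup xs) (sym (cyc-last m)))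

joins-sym : ∀ {n} {e : Fin n × Fin n} {a x} → Joins e a x → Joins e x a
joins-sym (inj₁ p) = inj₂ p
joins-sym (inj₂ p) = inj₁ p

joins-endpoint : ∀ {n} {e : Fin n × Fin n} {a x y z} → Joins e a x → Joins e y z → a ≡ y ⊎ a ≡ z
joins-endpoint (inj₁ refl) (inj₁ e) = inj₁ (cong proj₁ e)
joins-endpoint (inj₁ refl) (inj₂ e) = inj₂ (cong proj₁ e)
joins-endpoint (inj₂ refl) (inj₁ e) = inj₂ (cong proj₂ e)
joins-endpoint (inj₂ refl) (inj₂ e) = inj₁ (cong proj₂ e)

module Walks {n} (E : Edges n) where

  edge : Fin (length E) → Fin n × Fin n
  edge = L.lookup E

  data Walk (S : Fin n → Set) : Fin n → Fin n → Set where
    nil  : ∀ {a} → S a → Walk S a a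
    cons : ∀ {a x b} (e : Fin (length E)) → S a → Joins (edge e) a x → Walk S x b → Walk S a b

  module _ {S : Fin n → Set} where

    len : ∀ {a b} → Walk S a b → ℕ
    len (nil _)        = 0
    len (cons _ _ _ w) = suc (len w)

    vertices : ∀ {a b} (w : Walk S a b) → Vec (Fin n) (suc (len w))
    later    : ∀ {a b} (w : Walk S a b) → Vec (Fin n) (len w)
    vertices {a} w = a ∷ later w
    later (nil _)        = []
    later (cons _ _ _ w) = vertices w

    edges : ∀ {a b} (w : Walk S a b) → Vec (Fin (length E)) (len w)
    edges (nil _)        = []
    edges (cons e _ _ w) = e ∷ edges w

    IsPath : ∀ {a b} → Walk S a b → Set
    IsPath w = Distinct (vertices w) × Distinct (edges w)

    vertices-in : ∀ {a b} (w : Walk S a b) i → S (lookup (vertices w) i)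
    vertices-in (nil s)        zero    = s
    vertices-in (cons _ s _ _) zero    = s
    vertices-in (cons _ _ _ w) (suc i) = vertices-in w i

    edge-ends : ∀ {a b} (w : Walk S a b) (i : Fin (len w)) →
      Joins (edge (lookup (edges w) i)) (lookup (vertices w) (inject₁ i)) (lookup (vertices w) (suc i))
    edge-ends (cons e _ j w) zero    = j
    edge-ends (cons e _ j w) (suc i) = edge-ends w i

    edge-avoided : ∀ {a b v u e} (w : Walk S a b) → Fresh v (vertices w) →
      Joins (edge e) v u → Fresh e (edges w)
    edge-avoided w v∉ j i refl with joins-endpoint j (edge-ends w i)
    ... | inj₁ q = v∉ (inject₁ i) (sym q)
    ... | inj₂ q = v∉ (suc i) (sym q)

    suffix : ∀ {x b} (w : Walk S x b) (i : Fin (suc (len w))) → IsPath w →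
      Σ (Walk S (lookup (vertices w) i) b) IsPath
    suffix w              zero    path = w , path
    suffix (nil _)        (suc ())
    suffix (cons e s j w) (suc i) (dv , de) = suffix w i (distinct-tail dv , distinct-tail de)

    erase-loops : ∀ {a b} → Walk S a b → Σ (Walk S a b) IsPath
    erase-loops (nil s) = nil s , distinct-∷ (λ ()) distinct-[] , distinct-[]
    erase-loops {a} {b} (cons e s j w) with erase-loops w
    ... | p , dv , de with any? (λ i → lookup (vertices p) i ≟ a)
    ... | yes (i , q) = subst (λ z → Σ (Walk S z b) IsPath) q (suffix p i (dv , de))
    ... | no a∉       =
      cons e s j p , distinct-∷ a∉p dv , distinct-∷ (edge-avoided p a∉p j) de
      where
      a∉p : Fresh a (vertices p)
      a∉p i q = a∉ (i , q)

    _++_ : ∀ {a b c} → Walk S a b → Walk S b c → Walk S a c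
    nil _        ++ w′ = w′
    cons e s j w ++ w′ = cons e s j (w ++ w′)

  weaken : ∀ {S S′ : Fin n → Set} → (∀ {x} → S x → S′ x) → ∀ {a b} → Walk S a b → Walk S′ a b
  weaken f (nil s)        = nil (f s)
  weaken f (cons e s j w) = cons e (f s) j (weaken f w)

  conn-end : ∀ {W : Subset n} {u v} → Conn E W u v → v ∈ W
  conn-end (here uW)          = uW
  conn-end (step _ _ _ wW)    = wW

  conn⇒walk : ∀ {W : Subset n} {u v} → Conn E W u v → Walk (_∈ W) u v
  conn⇒walk (here uW)           = nil uW
  conn⇒walk (step c e∈E j wW) =
    conn⇒walk c ++ cons (index e∈E) (conn-end c) (subst (λ e → Joins e _ _) (lookup-index e∈E) j) (nil wW)

  close-cycle : ∀ {S : Fin n → Set} {a b v e₁ e₂} (T : Subset n) → (∀ {x} → S x → x ∈ T) →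
    v ∈ T → ¬ S v → e₁ ≢ e₂ → Joins (edge e₁) v a → Joins (edge e₂) b v → Walk S a b → Cycle E T
  close-cycle {S} {a} {b} {v} {e₁} {e₂} T S⊆T vT v∉S e₁≢e₂ j₁ j₂ walk = record
    { m      = suc (len p)
    ; vs     = lookup vs
    ; es     = lookup es
    ; vs-inj = distinct-∷ v∉p dv
    ; es-inj = distinct-∷ (fresh-∷ʳ (edges p) (edge-avoided p v∉p j₁) (e₁≢e₂ ∘ sym))
                          (distinct-∷ʳ (edges p) (edge-avoided p v∉p (joins-sym j₂)) de)
    ; vs-in  = vs-in
    ; joins  = λ i → subst (Joins (edge (lookup es i)) (lookup vs i)) (lookup-∷ʳ-cyc vs i) (consecutive i)
    }
    where
    path = erase-loops walk
    p    = proj₁ path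
    dv   = proj₁ (proj₂ path)
    de   = proj₂ (proj₂ path)
    vs   = v ∷ vertices p
    es   = e₁ ∷ (edges p ∷ʳ e₂)
    v∉p : Fresh v (vertices p)
    v∉p i q = v∉S (subst S q (vertices-in p i))
    vs-in : ∀ i → lookup vs i ∈ T
    vs-in zero    = vT
    vs-in (suc i) = S⊆T (vertices-in p i)
    along : ∀ {x} (w : Walk S x b) (i : Fin (suc (len w))) →
      Joins (edge (lookup (edges w ∷ʳ e₂) i)) (lookup (vertices w) i) (lookup (vertices w ∷ʳ v) (suc i))
    along (nil _)        zero    = j₂
    along (cons _ _ j _) zero    = j
    along (cons _ _ _ w) (suc i) = along w i
    consecutive : ∀ i → Joins (edge (lookup es i)) (lookup vs i) (lookup (vs ∷ʳ v) (suc i))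
    consecutive zero    = j₁
    consecutive (suc i) = along p i

EdgeInto : ∀ {n} (E : Edges n) (A : Subset n) (v : Fin n) (i : Fin (length E)) → Set
EdgeInto {n} E A v i = ∃[ x ] (Joins (L.lookup E i) v x × x ∈ A)

counted-edge-into : ∀ {n} (A : Subset n) {v} (a b : Fin n) →
  (((a =ᵇ v) ∧ lookup A b) ∨ ((b =ᵇ v) ∧ lookup A a)) ≡ true →
  ∃[ x ] (Joins (a , b) v x × x ∈ A)
counted-edge-into A {v} a b h with ∨-true ((a =ᵇ v) ∧ lookup A b) h
... | inj₁ h₁ with ∧-true (a =ᵇ v) h₁
...   | av , bA = b , inj₁ (cong (_, b) (=ᵇ⇒≡ a v av)) , lookup⇒[]= b A bA
counted-edge-into A {v} a b h | inj₂ h₂ with ∧-true (b =ᵇ v) h₂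
...   | bv , aA = a , inj₂ (cong (a ,_) (=ᵇ⇒≡ b v bv)) , lookup⇒[]= a A aA

edge-from-degree : ∀ {n} (E : Edges n) A v → 1 ≤ deg E A v → Σ[ i ∈ Fin (length E) ] EdgeInto E A v i
edge-from-degree [] A v ()
edge-from-degree ((a , b) ∷ E) A v h with ((a =ᵇ v) ∧ lookup A b) ∨ ((b =ᵇ v) ∧ lookup A a) in counted
... | true  = zero , counted-edge-into A a b counted
... | false with edge-from-degree E A v h
...   | i , into = suc i , into

edges-from-degree : ∀ {n} (E : Edges n) A v → 2 ≤ deg E A v →
  Σ[ i ∈ Fin (length E) ] Σ[ j ∈ Fin (length E) ] (i ≢ j × EdgeInto E A v i × EdgeInto E A v j)
edges-from-degree [] A v ()
edges-from-degree ((a , b) ∷ E) A v h with ((a =ᵇ v) ∧ lookup A b) ∨ ((b =ᵇ v) ∧ lookup A a) in counted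
... | true with edge-from-degree E A v (≤-pred h)
...   | j , into = zero , suc j , (λ ()) , counted-edge-into A a b counted , into
edges-from-degree ((a , b) ∷ E) A v h | false with edges-from-degree E A v h
...   | i , j , i≢j , into₁ , into₂ = suc i , suc j , i≢j ∘ suc-injective , into₁ , into₂

module _ {m : ℕ} (r r′ : Fin (suc m)) (r≢r′ : r ≢ r′) where

  -- relabel by Fin m, sending r′ to the label of r and otherwise injectively
  merge : Fin (suc m) → Fin m
  merge x with x ≟ r′
  ... | yes _   = punchOut {i = r′} {j = r} (r≢r′ ∘ sym)
  ... | no x≢r′ = punchOut (x≢r′ ∘ sym)

  merge-identifies : ∀ x y → merge x ≡ merge y → x ≡ y ⊎ (x ≡ r′ × y ≡ r) ⊎ (x ≡ r × y ≡ r′)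
  merge-identifies x y eq with x ≟ r′ | y ≟ r′
  ... | yes x≡r′ | yes y≡r′ = inj₁ (trans x≡r′ (sym y≡r′))
  ... | yes x≡r′ | no y≢r′  = inj₂ (inj₁ (x≡r′ , sym (punchOut-injective (r≢r′ ∘ sym) (y≢r′ ∘ sym) eq)))
  ... | no x≢r′  | yes y≡r′ = inj₂ (inj₂ (punchOut-injective (x≢r′ ∘ sym) (r≢r′ ∘ sym) eq , y≡r′))
  ... | no x≢r′  | no y≢r′  = inj₁ (punchOut-injective (x≢r′ ∘ sym) (y≢r′ ∘ sym) eq)

Attachable : ∀ {n} → Edges n → Subset n → Subset n → Fin n → Set
Attachable E W T v = v ∈ T × v ∉ W × 2 ≤ deg E W v

module ClassMerging {n} (E : Edges n) (W T : Subset n)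
                    (W⊆T : ∀ {x} → x ∈ W → x ∈ T) (forest : IsForest E T) where
  open Walks E

  W+ : List (Fin n) → Fin n → Set
  W+ L x = x ∈ W ⊎ x ∈ₗ L

  Classes : List (Fin n) → ℕ → Set
  Classes L m = Σ[ h ∈ (Fin n → Fin m) ]
    (∀ {u w} → u ∈ W → w ∈ W → h u ≡ h w → Walk (W+ L) u w)

  initial-classes : ∀ {ρ} (c : Fin n → Fin ρ) →
    (∀ {u w} → u ∈ W → w ∈ W → c u ≡ c w → Conn E W u w) → Classes [] ρ
  initial-classes c same⇒conn = c , λ uW wW e → weaken inj₁ (conn⇒walk (same⇒conn uW wW e))

  grow : ∀ {L v x y} → Walk (W+ L) x y → Walk (W+ (v ∷ L)) x y
  grow = weaken (λ { (inj₁ xW) → inj₁ xW ; (inj₂ x∈L) → inj₂ (there x∈L) })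

  W+⊆T : ∀ {L x} → (∀ {y} → y ∈ₗ L → y ∈ T) → W+ L x → x ∈ T
  W+⊆T L⊆T (inj₁ xW)  = W⊆T xW
  W+⊆T L⊆T (inj₂ x∈L) = L⊆T x∈L

  ∉W+ : ∀ {L v} → v ∉ W → v ∉ₗ L → ¬ W+ L v
  ∉W+ v∉W v∉L (inj₁ vW)  = v∉W vW
  ∉W+ v∉W v∉L (inj₂ v∈L) = v∉L v∈L

  -- attaching a new attachable vertex v merges two labels: its two
  -- W-neighbours are differently labelled, for otherwise a walk between
  -- them closes a cycle through v inside T
  attach : ∀ {L m v} → Attachable E W T v → v ∉ₗ L → (∀ {x} → x ∈ₗ L → x ∈ T) →
    Classes L m → Σ[ m′ ∈ ℕ ] (suc m′ ≡ m × Classes (v ∷ L) m′)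
  attach {L} {m} {v} (vT , v∉W , deg≥2) v∉L L⊆T (h , walk)
    with edges-from-degree E W v deg≥2
  ... | i , j , i≢j , (a , ja , aW) , (b , jb , bW) = attach-to m h walk
    where
    via-v : ∀ {u w x y k l} → Walk (W+ L) u x → x ∈ W → Joins (edge k) v x →
      Joins (edge l) v y → Walk (W+ L) y w → Walk (W+ (v ∷ L)) u w
    via-v ux xW jx jy yw =
      grow ux ++ cons _ (inj₁ xW) (joins-sym jx) (cons _ (inj₂ (here refl)) jy (grow yw))
    attach-to : ∀ m (h : Fin n → Fin m) → (∀ {u w} → u ∈ W → w ∈ W → h u ≡ h w → Walk (W+ L) u w) →
      Σ[ m′ ∈ ℕ ] (suc m′ ≡ m × Classes (v ∷ L) m′)
    attach-to zero    h _ with h a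
    ... | ()
    attach-to (suc m′) h walk with h a ≟ h b
    ... | yes same = ⊥-elim (forest (close-cycle T (W+⊆T L⊆T) vT (∉W+ v∉W v∉L) i≢j ja (joins-sym jb) (walk aW bW same)))
    ... | no differ = m′ , refl , merge (h a) (h b) differ ∘ h , merged
      where
      merged : ∀ {u w} → u ∈ W → w ∈ W → merge (h a) (h b) differ (h u) ≡ merge (h a) (h b) differ (h w) →
        Walk (W+ (v ∷ L)) u w
      merged {u} {w} uW wW eq with merge-identifies (h a) (h b) differ (h u) (h w) eq
      ... | inj₁ same                = grow (walk uW wW same)
      ... | inj₂ (inj₁ (ub , wa))    = via-v (walk uW bW ub) bW jb ja (walk aW wW (sym wa))
      ... | inj₂ (inj₂ (ua , wb))    = via-v (walk uW aW ua) aW ja jb (walk bW wW (sym wb))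

  classes-after : ∀ {ρ} → Classes [] ρ → ∀ L → Unique L → (∀ {v} → v ∈ₗ L → Attachable E W T v) →
    Σ[ m ∈ ℕ ] (length L + m ≡ ρ × Classes L m)
  classes-after {ρ} initial [] _ _ = ρ , refl , initial
  classes-after initial (v ∷ L) (v∉L ∷ unique) att
    with classes-after initial L unique (att ∘ there)
  ... | m , counted , classes
    with attach (att (here refl)) (All¬⇒¬Any v∉L) (proj₁ ∘ att ∘ there) classes
  ... | m′ , refl , classes′ = m′ , trans (sym (+-suc (length L) m′)) counted , classes′

  attachable-bound : ∀ {ρ} → Classes [] ρ → ∀ L → Unique L →
    (∀ {v} → v ∈ₗ L → Attachable E W T v) → length L ≤ ρ
  attachable-bound initial L unique att with classes-after initial L unique att
  ... | m , counted , _ = subst (length L ≤_) counted (m≤m+n (length L) m)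

special-info : ∀ {n} (E : Edges n) W R d v → isSpecialᵇ E W R d v ≡ true →
  v ∉ W × deg E W v ≡ d
special-info E W R d v h with ∧-true (not (lookup W v)) h
... | v∉W , rest with ∧-true (not (lookup R v)) rest
... | _ , rest′ with ∧-true (deg E W v ≡ᵇ d) rest′
... | deg≡d , _ = lookup-false⇒∉ W (not-true v∉W) , ≡ᵇ⇒≡ _ _ (subst B.T (sym deg≡d) tt)

special⇒attachable : ∀ {n} (E : Edges n) W R X v →
  ((isSpecialᵇ E W R 2 v ∨ isSpecialᵇ E W R 3 v) ∧ not (lookup X v)) ≡ true →
  Attachable E W (compl X) v
special⇒attachable E W R X v h with ∧-true (isSpecialᵇ E W R 2 v ∨ isSpecialᵇ E W R 3 v) h
... | special , v∉X = x∉p⇒x∈∁p (lookup-false⇒∉ X (not-true v∉X)) , degree-info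
  where
  degree-info : v ∉ W × 2 ≤ deg E W v
  degree-info with ∨-true (isSpecialᵇ E W R 2 v) special
  ... | inj₁ nice with special-info E W R 2 v nice
  ...   | v∉W , deg≡2 = v∉W , subst (2 ≤_) (sym deg≡2) ≤-refl
  degree-info | inj₂ tent with special-info E W R 3 v tent
  ...   | v∉W , deg≡3 = v∉W , subst (2 ≤_) (sym deg≡3) (s≤s (s≤s z≤n))

nice-tent-disjoint : ∀ {n} (E : Edges n) W R v →
  isSpecialᵇ E W R 2 v ≡ true → isSpecialᵇ E W R 3 v ≡ true → ⊥
nice-tent-disjoint E W R v nice tent
  with trans (sym (proj₂ (special-info E W R 2 v nice))) (proj₂ (special-info E W R 3 v tent))
... | ()

lemma2 : ∀ {n} (E : Edges n) (W R : Subset n) (k : ℕ)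
         → IsForest E (compl W)
         → (∀ {v} → v ∈ R → v ∉ W)
         → IsYes E W R k
         → ∀ ρ → NumComponents E W ρ
         → + 0 ℤ.≤ (+ k ℤ.+ + ρ) - (+ numNice E W R ℤ.+ + numTents E W R)
lemma2 {n} E W R k _ _ (X , X-avoids , ∣X∣≤k , _ , G-X-forest) ρ (c , _ , components) =
  i≤j⇒0≤j-i (+≤+ (begin
    numNice E W R + numTents E W R      ≡⟨ cong₂ _+_ (countV≡count nice) (countV≡count tent) ⟩
    count nice + count tent             ≤⟨ count-disjoint-split nice tent (lookup X) (nice-tent-disjoint E W R) ⟩
    count (lookup X) + count outside    ≡⟨ cong₂ _+_ (sym (∣∣≡count X)) (sym (countV≡count outside)) ⟩
    ∣ X ∣ + countV outside              ≤⟨ +-mono-≤ ∣X∣≤k outside-bound ⟩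
    k + ρ                               ∎))
  where
  open ≤-Reasoning
  nice tent outside : Fin n → Bool
  nice    = isSpecialᵇ E W R 2
  tent    = isSpecialᵇ E W R 3
  outside = λ v → (nice v ∨ tent v) ∧ not (lookup X v)
  W⊆G-X : ∀ {x} → x ∈ W → x ∈ compl X
  W⊆G-X xW = x∉p⇒x∈∁p (λ xX → proj₁ (X-avoids xX) xW)
  open ClassMerging E W (compl X) W⊆G-X G-X-forest
  outside-bound : countV outside ≤ ρ
  outside-bound = attachable-bound
    (initial-classes c (λ {u} {w} uW wW → Equivalence.to (components u w uW wW)))
    (filter (λ v → outside v B.≟ true) (allFin n)) (filter⁺ _ (allFin⁺ n))
    (λ {v} v∈ → special⇒attachable E W R X v (proj₂ (∈-filter⁻ (λ v → outside v B.≟ true) {xs = allFin n} v∈)))
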